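{- For each $i\in\{3,4\}$, the $\Sigma_f$-theory $\mathcal{T}_i$ is not stably infinite with respect to $\{\sigma_1\}$.
   Context: $\Sigma_f$ is the one-sorted signature (sort $\sigma_1$) with a single unary function symbol $f$. $f^0(x)=x$, $f^{k+1}(x)=f(f^k(x))$. For $n\ge1$, $\mathrm{cycle}_n(x)$ is $f^n(x)=x\wedge\bigwedge_{m\mid n,\,m\ne n}f^m(x)\ne x$. Fix an undecidable set $P$ of prime numbers all $\ge7$. Let $A_1=\{(\exists x\,\mathrm{cycle}_n(x))\to\forall x\,f^2(x)\ne x : n\in P\}$. $\mathcal{T}_3$ is the class of $\Sigma_f$-interpretations satisfying $A_1\cup\{(\exists x\,f(x)=x)\to\forall x\forall y\,x=y\}$; $\mathcal{T}_4$ is axiomatized by $A_1\cup\{\neg\exists x\,\mathrm{cycle}_6(x),\ (\exists x\,f(x)=x)\to\forall x\forall y\,x=y\}$. A theory $\mathcal{T}$ is stably infinite w.r.t. $\{\sigma_1\}$ if every quantifier-free formula satisfied by some $\mathcal{T}$-interpretation is satisfied by some $\mathcal{T}$-interpretation with infinite domain. -}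

module Defs where

open import Data.Nat using (ℕ; zero; suc; _≤_)
open import Data.Nat.Divisibility using (_∣_)
open import Data.Nat.Primality using (Prime)
open import Data.Fin using (Fin)
open import Data.Product using (Σ; ∃; _×_)
open import Data.Sum using (_⊎_)
open import Data.Unit using (⊤)
open import Data.Empty using (⊥)
open import Relation.Nullary using (¬_)
open import Relation.Binary.PropositionalEquality using (_≡_; _≢_)
open import Function.Bundles using (_↔_)

-- A Σ_f-interpretation: a domain (the sort σ₁) with a unary function f.
-- Equality is interpreted as propositional equality on the domain.
record Interp : Set₁ where
  field
    Carrier : Set
    fn      : Carrier → Carrier
open Interp public

iter : {A : Set} → (A → A) → ℕ → A → A
iter g zero    x = x
iter g (suc k) x = g (iter g k x)

Cycle : (M : Interp) → ℕ → Carrier M → Set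
Cycle M n x = (iter (fn M) n x ≡ x) × (∀ m → m ∣ n → m ≢ n → iter (fn M) m x ≢ x)

data Term : Set where
  var : ℕ → Term
  app : Term → Term

data QF : Set where
  tt  : QF
  ff  : QF
  _≐_ : Term → Term → QF
  ¬'_ : QF → QF
  _∧'_ : QF → QF → QF
  _∨'_ : QF → QF → QF

evalT : (M : Interp) → (ℕ → Carrier M) → Term → Carrier M
evalT M s (var i) = s i
evalT M s (app t) = fn M (evalT M s t)

⟦_⟧ : QF → (M : Interp) → (ℕ → Carrier M) → Set
⟦ tt ⟧     M s = ⊤
⟦ ff ⟧     M s = ⊥
⟦ t ≐ u ⟧  M s = evalT M s t ≡ evalT M s u
⟦ ¬' φ ⟧   M s = ¬ ⟦ φ ⟧ M s
⟦ φ ∧' ψ ⟧ M s = ⟦ φ ⟧ M s × ⟦ ψ ⟧ M s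
⟦ φ ∨' ψ ⟧ M s = ⟦ φ ⟧ M s ⊎ ⟦ ψ ⟧ M s

Satisfies : Interp → QF → Set
Satisfies M φ = Σ (ℕ → Carrier M) λ s → ⟦ φ ⟧ M s

FiniteDom : Interp → Set
FiniteDom M = ∃ λ n → Fin n ↔ Carrier M

InfiniteDom : Interp → Set
InfiniteDom M = ¬ FiniteDom M

Theory : Set₁
Theory = Interp → Set

StablyInfinite : Theory → Set₁
StablyInfinite T =
  ∀ (φ : QF) →
  (Σ Interp λ M → T M × Satisfies M φ) →
  Σ Interp λ M → T M × InfiniteDom M × Satisfies M φ

A₁ : (ℕ → Set) → Interp → Set
A₁ P M = ∀ n → P n → (∃ λ x → Cycle M n x) → ∀ y → iter (fn M) 2 y ≢ y

FixTrivial : Interp → Set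
FixTrivial M = (∃ λ x → fn M x ≡ x) → ∀ (x y : Carrier M) → x ≡ y

NoCycle6 : Interp → Set
NoCycle6 M = ¬ (∃ λ x → Cycle M 6 x)

T₃ : (ℕ → Set) → Theory
T₃ P M = A₁ P M × FixTrivial M

T₄ : (ℕ → Set) → Theory
T₄ P M = A₁ P M × NoCycle6 M × FixTrivial M

PrimesGe7 : (ℕ → Set) → Set
PrimesGe7 P = ∀ n → P n → Prime n × 7 ≤ n

{-# OPTIONS --safe #-}
-- The formula f(x₀) = x₀ holds in the one-point interpretation, which is a model of
-- both theories; but in any of their models a fixed point collapses the domain to a
-- single element, so no infinite model satisfies it.
module Submission where

open import Defs
open import Data.Nat using (ℕ; nonTrivial⇒≢1)
open import Data.Nat.Divisibility using (1∣_)
open import Data.Nat.Primality using (Prime; prime⇒nonTrivial)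
open import Data.Product using (Σ; _×_; _,_; proj₁; proj₂)
open import Data.Fin using (Fin; zero; suc)
open import Data.Unit using (⊤; tt)
open import Data.Empty using (⊥-elim)
open import Function using (_∘_)
open import Function.Bundles using (_↔_; mk↔ₛ′)
open import Relation.Nullary using (¬_)
open import Relation.Binary.PropositionalEquality using (_≡_; _≢_; refl; ≢-sym)

pointed-subsingleton↔Fin1 : {A : Set} → A → (∀ (x y : A) → x ≡ y) → Fin 1 ↔ A
pointed-subsingleton↔Fin1 a all-equal =
  mk↔ₛ′ (λ _ → a) (λ _ → zero) (all-equal a) λ { zero → refl ; (suc ()) }

fixed-point : QF
fixed-point = app (var 0) ≐ var 0

fixTrivial∧fixed-point⇒finite : (M : Interp) → FixTrivial M →
                                Satisfies M fixed-point → FiniteDom M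
fixTrivial∧fixed-point⇒finite M fixTrivial (s , fs₀≡s₀) =
  1 , pointed-subsingleton↔Fin1 (s 0) (fixTrivial (s 0 , fs₀≡s₀))

fixTrivial⇒¬stablyInfinite : (T : Theory) → (∀ M → T M → FixTrivial M) →
                             (Σ Interp λ M → T M × Satisfies M fixed-point) →
                             ¬ StablyInfinite T
fixTrivial⇒¬stablyInfinite T fixTrivial model stablyInfinite
  with stablyInfinite fixed-point model
... | M , TM , infinite , sat = infinite (fixTrivial∧fixed-point⇒finite M (fixTrivial M TM) sat)

fixed-point⇒¬cycle : (M : Interp) {n : ℕ} {x : Carrier M} →
                     fn M x ≡ x → n ≢ 1 → ¬ Cycle M n x
fixed-point⇒¬cycle M {n} fx≡x n≢1 (_ , minimal) = minimal 1 (1∣ n) (≢-sym n≢1) fx≡x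

point : Interp
point = record { Carrier = ⊤ ; fn = λ x → x }

point-fixTrivial : FixTrivial point
point-fixTrivial _ tt tt = refl

point-noCycle6 : NoCycle6 point
point-noCycle6 (_ , cycle) = fixed-point⇒¬cycle point refl (λ ()) cycle

point-A₁ : (P : ℕ → Set) → (∀ n → P n → Prime n) → A₁ P point
point-A₁ P primes n n∈P (_ , cycle) =
  ⊥-elim (fixed-point⇒¬cycle point refl (nonTrivial⇒≢1 {{prime⇒nonTrivial (primes n n∈P)}}) cycle)

point-fixed-point : Satisfies point fixed-point
point-fixed-point = (λ _ → tt) , refl

lemma6 : (P : ℕ → Set) → PrimesGe7 P →
         ¬ StablyInfinite (T₃ P) × ¬ StablyInfinite (T₄ P)
lemma6 P primesGe7 =
    fixTrivial⇒¬stablyInfinite (T₃ P) (λ _ → proj₂)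
      (point , (point-A₁ P primes , point-fixTrivial) , point-fixed-point)
  , fixTrivial⇒¬stablyInfinite (T₄ P) (λ _ → proj₂ ∘ proj₂)
      (point , (point-A₁ P primes , point-noCycle6 , point-fixTrivial) , point-fixed-point)
  where
  primes : ∀ n → P n → Prime n
  primes n = proj₁ ∘ primesGe7 n
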